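{- Let $A_0(n):=1$ for all $n\in\mathbb{N}$, and for $r\in\mathbb{N}=\{1,2,\ldots\}$ let \[ A_r(n):=\frac{1}{n^r}\sum_{k_1,\ldots,k_r=1}^{n}\gcd(k_1\cdots k_r,n)\qquad(n\in\mathbb{N}). \] Then for all $n,r\in\mathbb{N}$, \[ A_r(n)=\sum_{d\mid n}\frac{\phi(d)\,A_{r-1}(d)}{d}, \] where $\phi$ is Euler's totient function. -}

module Defs where

open import Data.Nat as ℕ using (ℕ; zero; suc; _^_; NonZero)
open import Data.Nat.Properties using (m^n≢0)
open import Data.Nat.GCD using (gcd)
open import Data.Nat.Divisibility using (_∣?_)
open import Data.List using (List; []; _∷_; map; filter; length; concatMap)
open import Data.Nat.ListAction using (sum) renaming (product to productℕ)
open import Data.Integer using (+_)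
open import Data.Rational using (ℚ; _/_; _*_; _+_; 0ℚ; 1ℚ)
open import Relation.Binary.PropositionalEquality using (_≡_)
open import Data.Nat using (_≟_)

range1 : ℕ → List ℕ
range1 zero = []
range1 (suc n) = range1 n Data.List.++ (suc n ∷ [])

tuples : ℕ → ℕ → List (List ℕ)
tuples zero n = [] ∷ []
tuples (suc r) n = concatMap (λ k → map (k ∷_) (tuples r n)) (range1 n)

gcdSum : ℕ → ℕ → ℕ
gcdSum r n = sum (map (λ ks → gcd (productℕ ks) n) (tuples r n))

-- A r n = (1/n^r) Σ gcd(k₁⋯k_r, n); for r = 0 the empty tuple gives gcd(1,n) = 1 = A₀(n).
-- Defined for n ≥ 1 (division needs n ≠ 0).
A : ℕ → (n : ℕ) → .{{NonZero n}} → ℚ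
A zero n = 1ℚ
A (suc r) n = (+ gcdSum (suc r) n) / (n ^ suc r)
  where instance
    _ : NonZero (n ^ suc r)
    _ = m^n≢0 n (suc r)

φ : ℕ → ℕ
φ d = length (filter (λ k → gcd k d ≟ 1) (range1 d))

divisors : ℕ → List ℕ
divisors n = filter (λ d → d ∣? n) (range1 n)

sumℚ : List ℚ → ℚ
sumℚ [] = 0ℚ
sumℚ (x ∷ xs) = x + sumℚ xs

divisorSum : (r : ℕ) → ℕ → ℚ
divisorSum r n = sumℚ (map term (divisors n))
  where
  term : ℕ → ℚ
  term zero = 0ℚ   -- never occurs: divisors are ≥ 1
  term (suc d') = ((+ φ (suc d')) / 1) * A r (suc d') * ((+ 1) / suc d')

{-# OPTIONS --safe #-}
-- Write S r N for gcdSum r N and group the k ∈ [1, N] by d = N / gcd k N, so that N = q d with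
-- q = gcd k N. For such k, k / q is coprime to d, hence gcd (k P) N = q · gcd P d; exactly φ d
-- values of k occur; and gcd P d depends only on the tuple modulo d, so the r-tuples in [1, N]
-- contribute q^r S r d. Thus S (r+1) N = Σ_{d ∣ N} φ d · q^(r+1) · S r d, and dividing by
-- N^(r+1) = q^(r+1) d^(r+1) turns each term into φ d · A r d / d.
module Submission where

open import Defs
open import Level using (Level)
open import Data.Integer as ℤ using ()
open import Data.Integer.Properties using (pos-*; pos-+)
open import Data.List using (List; []; _∷_; map; filter; length; concatMap; _++_)
open import Data.List.Properties using (map-++; map-cong; map-cong-local)
open import Data.List.Relation.Unary.All as All using (All)
open import Data.List.Relation.Unary.All.Properties using (all-filter)
open import Data.Nat as ℕ using (ℕ; zero; suc; _+_; _*_; _^_; _≤_; _≟_; NonZero; z≤n; s≤s)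
open import Data.Nat.Properties
open import Data.Nat.Divisibility
  using (_∣_; _∣?_; divides; ∣-antisym; ∣-refl; ∣⇒≤; ∣m+n∣m⇒∣n; ∣m∣n⇒∣m+n; ∣m⇒∣m*n; ∣n⇒∣m*n; 0∣⇒≡0)
open import Data.Nat.GCD
open import Data.Nat.Coprimality using (Coprime; coprime-factors; GCD≡1⇒coprime)
open import Data.Nat.ListAction using (sum) renaming (product to productℕ)
open import Data.Nat.ListAction.Properties using (sum-++)
open import Data.Nat.Tactic.RingSolver using (solve-∀)
open import Data.Product using (_,_)
open import Data.Sum using (inj₂)
open import Data.Rational as ℚ using (_/_; toℚᵘ)
open import Data.Rational.Properties
  using (toℚᵘ-injective; toℚᵘ-fromℚᵘ; toℚᵘ-homo-+; toℚᵘ-homo-*; fromℚᵘ-cong; 0/n≡0)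
open import Data.Rational.Unnormalised as ℚᵘ using (mkℚᵘ; *≡*)
import Data.Rational.Unnormalised.Properties as ℚᵘ
open import Function using (_∘_)
open import Relation.Binary.PropositionalEquality
open import Relation.Nullary using (Dec; yes; no; ¬_; contradiction)
open import Relation.Unary using (Pred; Decidable)

private
  variable
    a p : Level
    X Y : Set a

∑ : List X → (X → ℕ) → ℕ
∑ xs f = sum (map f xs)

∑-cong : (xs : List X) {f g : X → ℕ} → (∀ x → f x ≡ g x) → ∑ xs f ≡ ∑ xs g
∑-cong xs f≗g = cong sum (map-cong f≗g xs)

∑-++ : (xs ys : List X) (f : X → ℕ) → ∑ (xs ++ ys) f ≡ ∑ xs f + ∑ ys f
∑-++ xs ys f = trans (cong sum (map-++ f xs ys)) (sum-++ (map f xs) (map f ys))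

∑-map : (h : X → Y) (xs : List X) (f : Y → ℕ) → ∑ (map h xs) f ≡ ∑ xs (f ∘ h)
∑-map h []       f = refl
∑-map h (x ∷ xs) f = cong (f (h x) +_) (∑-map h xs f)

∑-concatMap : (g : X → List Y) (xs : List X) (f : Y → ℕ) →
              ∑ (concatMap g xs) f ≡ ∑ xs (λ x → ∑ (g x) f)
∑-concatMap g []       f = refl
∑-concatMap g (x ∷ xs) f =
  trans (∑-++ (g x) (concatMap g xs) f) (cong (∑ (g x) f +_) (∑-concatMap g xs f))

∑-const-0 : (xs : List X) → ∑ xs (λ _ → 0) ≡ 0
∑-const-0 []       = refl
∑-const-0 (x ∷ xs) = ∑-const-0 xs

∑-+ : (xs : List X) (f g : X → ℕ) → ∑ xs (λ x → f x + g x) ≡ ∑ xs f + ∑ xs g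
∑-+ []       f g = refl
∑-+ (x ∷ xs) f g =
  trans (cong (f x + g x +_) (∑-+ xs f g)) (+-+-assoc-swap (f x) (g x) (∑ xs f) (∑ xs g))
  where
  +-+-assoc-swap : ∀ m n o q → m + n + (o + q) ≡ m + o + (n + q)
  +-+-assoc-swap = solve-∀

∑-*ˡ : (xs : List X) (c : ℕ) (f : X → ℕ) → ∑ xs (λ x → c * f x) ≡ c * ∑ xs f
∑-*ˡ []       c f = sym (*-zeroʳ c)
∑-*ˡ (x ∷ xs) c f =
  trans (cong (c * f x +_) (∑-*ˡ xs c f)) (sym (*-distribˡ-+ c (f x) (∑ xs f)))

∑-*ʳ : (xs : List X) (c : ℕ) (f : X → ℕ) → ∑ xs (λ x → f x * c) ≡ ∑ xs f * c
∑-*ʳ xs c f = trans (∑-cong xs (λ x → *-comm (f x) c)) (trans (∑-*ˡ xs c f) (*-comm c (∑ xs f)))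

∑-swap : (xs : List X) (ys : List Y) (f : X → Y → ℕ) →
         ∑ xs (λ x → ∑ ys (f x)) ≡ ∑ ys (λ y → ∑ xs (λ x → f x y))
∑-swap []       ys f = sym (∑-const-0 ys)
∑-swap (x ∷ xs) ys f =
  trans (cong (∑ ys (f x) +_) (∑-swap xs ys f)) (sym (∑-+ ys (f x) (λ y → ∑ xs (λ x′ → f x′ y))))

𝟙 : {P : Set p} → Dec P → ℕ
𝟙 (yes _) = 1
𝟙 (no _)  = 0

𝟙-yes : {P : Set p} (P? : Dec P) → P → 𝟙 P? ≡ 1
𝟙-yes (yes _)  _  = refl
𝟙-yes (no ¬pf) pf = contradiction pf ¬pf

𝟙-no : {P : Set p} (P? : Dec P) → ¬ P → 𝟙 P? ≡ 0
𝟙-no (yes pf) ¬pf = contradiction pf ¬pf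
𝟙-no (no _)   _   = refl

𝟙-cong-⇔ : ∀ {q} {P : Set p} {Q : Set q} (P? : Dec P) (Q? : Dec Q) → (P → Q) → (Q → P) → 𝟙 P? ≡ 𝟙 Q?
𝟙-cong-⇔ (yes pf) Q? to from = sym (𝟙-yes Q? (to pf))
𝟙-cong-⇔ (no ¬pf) Q? to from = sym (𝟙-no Q? (¬pf ∘ from))

𝟙-*-cong : {P : Set p} (P? : Dec P) {m n : ℕ} → (P → m ≡ n) → 𝟙 P? * m ≡ 𝟙 P? * n
𝟙-*-cong (yes pf) m≡n = cong (1 *_) (m≡n pf)
𝟙-*-cong (no _)   m≡n = refl

length-filter-∑ : {P : Pred X p} (P? : Decidable P) (xs : List X) →
                  length (filter P? xs) ≡ ∑ xs (𝟙 ∘ P?)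
length-filter-∑ P? []       = refl
length-filter-∑ P? (x ∷ xs) with P? x
... | yes _ = cong suc (length-filter-∑ P? xs)
... | no  _ = length-filter-∑ P? xs

∑-filter : {P : Pred X p} (P? : Decidable P) (xs : List X) (f : X → ℕ) →
           ∑ (filter P? xs) f ≡ ∑ xs (λ x → 𝟙 (P? x) * f x)
∑-filter P? []       f = refl
∑-filter P? (x ∷ xs) f with P? x
... | yes _ = cong₂ _+_ (sym (+-identityʳ (f x))) (∑-filter P? xs f)
... | no  _ = ∑-filter P? xs f

∑-partition : ∀ {ℓ} {R : X → Y → Set ℓ} (R? : ∀ x y → Dec (R x y)) (xs : List X) (ys : List Y) →
              (∀ x → ∑ ys (λ y → 𝟙 (R? x y)) ≡ 1) → (F : X → ℕ) →
              ∑ xs F ≡ ∑ ys (λ y → ∑ xs (λ x → 𝟙 (R? x y) * F x))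
∑-partition R? xs ys unique F = begin
  ∑ xs F                                          ≡⟨ ∑-cong xs weight-one ⟩
  ∑ xs (λ x → ∑ ys (λ y → 𝟙 (R? x y) * F x))      ≡⟨ ∑-swap xs ys _ ⟩
  ∑ ys (λ y → ∑ xs (λ x → 𝟙 (R? x y) * F x))      ∎
  where
  open ≡-Reasoning
  weight-one : ∀ x → F x ≡ ∑ ys (λ y → 𝟙 (R? x y) * F x)
  weight-one x = sym (trans (∑-*ʳ ys (F x) (λ y → 𝟙 (R? x y)))
                            (trans (cong (_* F x) (unique x)) (*-identityˡ (F x))))

∑-range1-suc : ∀ n (f : ℕ → ℕ) → ∑ (range1 (suc n)) f ≡ ∑ (range1 n) f + f (suc n)
∑-range1-suc n f = trans (∑-++ (range1 n) (suc n ∷ []) f) (cong (∑ (range1 n) f +_) (+-identityʳ _))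

∑-range1-cong : ∀ n {f g : ℕ → ℕ} → (∀ {k} → 1 ≤ k → k ≤ n → f k ≡ g k) →
                ∑ (range1 n) f ≡ ∑ (range1 n) g
∑-range1-cong zero    f≗g = refl
∑-range1-cong (suc n) {f} {g} f≗g = begin
  ∑ (range1 (suc n)) f     ≡⟨ ∑-range1-suc n f ⟩
  ∑ (range1 n) f + f (suc n) ≡⟨ cong₂ _+_ (∑-range1-cong n (λ 1≤k k≤n → f≗g 1≤k (m≤n⇒m≤1+n k≤n)))
                                          (f≗g (s≤s z≤n) ≤-refl) ⟩
  ∑ (range1 n) g + g (suc n) ≡⟨ ∑-range1-suc n g ⟨
  ∑ (range1 (suc n)) g     ∎
  where open ≡-Reasoning

∑-range1-+ : ∀ m n (f : ℕ → ℕ) → ∑ (range1 (m + n)) f ≡ ∑ (range1 m) f + ∑ (range1 n) (λ k → f (m + k))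
∑-range1-+ m zero    f = begin
  ∑ (range1 (m + 0)) f ≡⟨ cong (λ l → ∑ (range1 l) f) (+-identityʳ m) ⟩
  ∑ (range1 m) f       ≡⟨ +-identityʳ _ ⟨
  ∑ (range1 m) f + 0   ∎
  where open ≡-Reasoning
∑-range1-+ m (suc n) f = begin
  ∑ (range1 (m + suc n)) f                ≡⟨ cong (λ l → ∑ (range1 l) f) (+-suc m n) ⟩
  ∑ (range1 (suc (m + n))) f              ≡⟨ ∑-range1-suc (m + n) f ⟩
  ∑ (range1 (m + n)) f + f (suc (m + n))
    ≡⟨ cong₂ _+_ (∑-range1-+ m n f) (cong f (sym (+-suc m n))) ⟩
  ∑ (range1 m) f + ∑ (range1 n) (λ k → f (m + k)) + f (m + suc n)
    ≡⟨ +-assoc (∑ (range1 m) f) _ _ ⟩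
  ∑ (range1 m) f + (∑ (range1 n) (λ k → f (m + k)) + f (m + suc n))
    ≡⟨ cong (_ +_) (∑-range1-suc n _) ⟨
  ∑ (range1 m) f + ∑ (range1 (suc n)) (λ k → f (m + k))
    ∎
  where open ≡-Reasoning

∑-range1-periodic : ∀ m q (f : ℕ → ℕ) → (∀ k → f (m + k) ≡ f k) →
                    ∑ (range1 (q * m)) f ≡ q * ∑ (range1 m) f
∑-range1-periodic m zero    f periodic = refl
∑-range1-periodic m (suc q) f periodic = begin
  ∑ (range1 (m + q * m)) f                                ≡⟨ ∑-range1-+ m (q * m) f ⟩
  ∑ (range1 m) f + ∑ (range1 (q * m)) (λ k → f (m + k))   ≡⟨ cong (_ +_) (∑-cong (range1 (q * m)) periodic) ⟩
  ∑ (range1 m) f + ∑ (range1 (q * m)) f                   ≡⟨ cong (_ +_) (∑-range1-periodic m q f periodic) ⟩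
  ∑ (range1 m) f + q * ∑ (range1 m) f                     ∎
  where open ≡-Reasoning

∑-range1-single : ∀ n {e} (f : ℕ → ℕ) → 1 ≤ e → e ≤ n →
                  (∀ {k} → 1 ≤ k → k ≤ n → k ≢ e → f k ≡ 0) → ∑ (range1 n) f ≡ f e
∑-range1-single zero    f 1≤e e≤0 _ = contradiction e≤0 (<⇒≱ 1≤e)
∑-range1-single (suc n) {e} f 1≤e e≤n vanish with e ≟ suc n
... | yes refl = begin
  ∑ (range1 (suc n)) f       ≡⟨ ∑-range1-suc n f ⟩
  ∑ (range1 n) f + f (suc n) ≡⟨ cong (_+ f (suc n)) (∑-range1-cong n below) ⟩
  ∑ (range1 n) (λ _ → 0) + f (suc n) ≡⟨ cong (_+ f (suc n)) (∑-const-0 (range1 n)) ⟩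
  f (suc n)                  ∎
  where
  open ≡-Reasoning
  below : ∀ {k} → 1 ≤ k → k ≤ n → f k ≡ 0
  below 1≤k k≤n = vanish 1≤k (m≤n⇒m≤1+n k≤n) (<⇒≢ (s≤s k≤n))
... | no e≢1+n = begin
  ∑ (range1 (suc n)) f       ≡⟨ ∑-range1-suc n f ⟩
  ∑ (range1 n) f + f (suc n) ≡⟨ cong₂ _+_ (∑-range1-single n f 1≤e (≤-pred (≤∧≢⇒< e≤n e≢1+n))
                                             (λ 1≤k k≤n → vanish 1≤k (m≤n⇒m≤1+n k≤n)))
                                          (vanish (s≤s z≤n) ≤-refl (e≢1+n ∘ sym)) ⟩
  f e + 0                    ≡⟨ +-identityʳ (f e) ⟩
  f e                        ∎
  where open ≡-Reasoning

∑-range1-multiples : ∀ q .{{_ : NonZero q}} d (f : ℕ → ℕ) → (∀ k → ¬ q ∣ k → f k ≡ 0) →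
                     ∑ (range1 (d * q)) f ≡ ∑ (range1 d) (λ j → f (j * q))
∑-range1-multiples q zero    f vanish = refl
∑-range1-multiples q (suc d) f vanish = begin
  ∑ (range1 (q + d * q)) f
    ≡⟨ cong (λ l → ∑ (range1 l) f) (+-comm q (d * q)) ⟩
  ∑ (range1 (d * q + q)) f
    ≡⟨ ∑-range1-+ (d * q) q f ⟩
  ∑ (range1 (d * q)) f + ∑ (range1 q) (λ k → f (d * q + k))
    ≡⟨ cong₂ _+_ (∑-range1-multiples q d f vanish) last-block ⟩
  ∑ (range1 d) (λ j → f (j * q)) + f (suc d * q)
    ≡⟨ ∑-range1-suc d _ ⟨
  ∑ (range1 (suc d)) (λ j → f (j * q))
    ∎
  where
  open ≡-Reasoning
  not-multiple : ∀ {k} → 1 ≤ k → k ≤ q → k ≢ q → ¬ q ∣ d * q + k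
  not-multiple {suc k} _ k≤q k≢q q∣dq+k =
    k≢q (≤-antisym k≤q (∣⇒≤ (∣m+n∣m⇒∣n q∣dq+k (∣n⇒∣m*n d ∣-refl))))
  last-block : ∑ (range1 q) (λ k → f (d * q + k)) ≡ f (suc d * q)
  last-block = trans (∑-range1-single q _ (ℕ.>-nonZero⁻¹ q) ≤-refl
                       (λ 1≤k k≤q k≢q → vanish _ (not-multiple 1≤k k≤q k≢q)))
                     (cong f (+-comm (d * q) q))

-- Arithmetic of gcd

gcd[m+n*o,n]≡gcd[m,n] : ∀ m n o → gcd (m + n * o) n ≡ gcd m n
gcd[m+n*o,n]≡gcd[m,n] m n o = ∣-antisym
  (gcd-greatest (∣m+n∣m⇒∣n′ (gcd[m,n]∣m (m + n * o) n) (∣m⇒∣m*n o (gcd[m,n]∣n (m + n * o) n)))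
                (gcd[m,n]∣n (m + n * o) n))
  (gcd-greatest (∣m∣n⇒∣m+n (gcd[m,n]∣m m n) (∣m⇒∣m*n o (gcd[m,n]∣n m n))) (gcd[m,n]∣n m n))
  where
  ∣m+n∣m⇒∣n′ : ∀ {d x y} → d ∣ x + y → d ∣ y → d ∣ x
  ∣m+n∣m⇒∣n′ {d} {x} {y} d∣x+y = ∣m+n∣m⇒∣n (subst (d ∣_) (+-comm x y) d∣x+y)

coprime⇒gcd[m*n,o]≡gcd[n,o] : ∀ {m o} n → Coprime m o → gcd (m * n) o ≡ gcd n o
coprime⇒gcd[m*n,o]≡gcd[n,o] {m} {o} n m⊥o = ∣-antisym
  (gcd-greatest (coprime-factors m⊥o (gcd[m,n]∣m (m * n) o , ∣m⇒∣m*n n (gcd[m,n]∣n (m * n) o)))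
                (gcd[m,n]∣n (m * n) o))
  (gcd-greatest (∣n⇒∣m*n m (gcd[m,n]∣m n o)) (gcd[m,n]∣n n o))

gcd[m*o,g*d]≡g*gcd[o,d] : ∀ {m g d} o .{{_ : NonZero g}} → gcd m (g * d) ≡ g →
                          gcd (m * o) (g * d) ≡ g * gcd o d
gcd[m*o,g*d]≡g*gcd[o,d] {m} {g} {d} o gcd≡g with gcd[m,n]∣m m (g * d)
... | divides m′ m≡m′*gcd = begin
  gcd (m * o) (g * d)          ≡⟨ cong (λ x → gcd (x * o) (g * d)) m≡m′*g ⟩
  gcd (m′ * g * o) (g * d)     ≡⟨ cong (λ x → gcd x (g * d)) (regroup m′ g o) ⟩
  gcd (g * (m′ * o)) (g * d)   ≡⟨ c*gcd[m,n]≡gcd[cm,cn] g (m′ * o) d ⟨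
  g * gcd (m′ * o) d           ≡⟨ cong (g *_) (coprime⇒gcd[m*n,o]≡gcd[n,o] o m′⊥d) ⟩
  g * gcd o d                  ∎
  where
  open ≡-Reasoning
  regroup : ∀ x y z → x * y * z ≡ y * (x * z)
  regroup = solve-∀
  m≡m′*g : m ≡ m′ * g
  m≡m′*g = trans m≡m′*gcd (cong (m′ *_) gcd≡g)
  m′⊥d : Coprime m′ d
  m′⊥d = GCD≡1⇒coprime (GCD-* (subst₂ (λ x y → GCD x y (1 * g)) m≡m′*g (*-comm g d)
                                      (subst (GCD m (g * d)) (trans gcd≡g (sym (*-identityˡ g)))
                                             (gcd-GCD m (g * d)))))

-- Only the multiples j q with j coprime to d have gcd (j q) (q d) = q.
∑-𝟙[gcd[k,q*d]≡q]≡φ[d] : ∀ q d .{{_ : NonZero q}} .{{_ : NonZero d}} →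
                          ∑ (range1 (q * d)) (λ k → 𝟙 (gcd k (q * d) ≟ q)) ≡ φ d
∑-𝟙[gcd[k,q*d]≡q]≡φ[d] q d = begin
  ∑ (range1 (q * d)) counted                  ≡⟨ cong (λ n → ∑ (range1 n) counted) (*-comm q d) ⟩
  ∑ (range1 (d * q)) counted                  ≡⟨ ∑-range1-multiples q d counted off-multiples ⟩
  ∑ (range1 d) (λ j → counted (j * q))        ≡⟨ ∑-cong (range1 d) on-multiples ⟩
  ∑ (range1 d) (λ j → 𝟙 (gcd j d ≟ 1))        ≡⟨ length-filter-∑ (λ j → gcd j d ≟ 1) (range1 d) ⟨
  φ d                                         ∎
  where
  open ≡-Reasoning
  counted : ℕ → ℕ
  counted k = 𝟙 (gcd k (q * d) ≟ q)
  off-multiples : ∀ k → ¬ q ∣ k → counted k ≡ 0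
  off-multiples k q∤k =
    𝟙-no (gcd k (q * d) ≟ q) (λ gcd≡q → q∤k (subst (_∣ k) gcd≡q (gcd[m,n]∣m k (q * d))))
  gcd[j*q,q*d]≡q*gcd[j,d] : ∀ j → gcd (j * q) (q * d) ≡ q * gcd j d
  gcd[j*q,q*d]≡q*gcd[j,d] j =
    trans (cong (λ x → gcd x (q * d)) (*-comm j q)) (sym (c*gcd[m,n]≡gcd[cm,cn] q j d))
  on-multiples : ∀ j → counted (j * q) ≡ 𝟙 (gcd j d ≟ 1)
  on-multiples j = 𝟙-cong-⇔ _ _
    (λ gcd≡q → *-cancelˡ-≡ (gcd j d) 1 q
                 (trans (sym (gcd[j*q,q*d]≡q*gcd[j,d] j)) (trans gcd≡q (sym (*-identityʳ q)))))
    (λ gcd≡1 → trans (gcd[j*q,q*d]≡q*gcd[j,d] j) (trans (cong (q *_) gcd≡1) (*-identityʳ q)))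

∑-tuples-suc : ∀ r n (F : List ℕ → ℕ) →
               ∑ (tuples (suc r) n) F ≡ ∑ (range1 n) (λ k → ∑ (tuples r n) (λ ks → F (k ∷ ks)))
∑-tuples-suc r n F = trans (∑-concatMap (λ k → map (k ∷_) (tuples r n)) (range1 n) F)
                           (∑-cong (range1 n) (λ k → ∑-map (k ∷_) (tuples r n) F))

Periodic : ℕ → (ℕ → ℕ) → Set
Periodic m f = ∀ x y → f (x + m * y) ≡ f x

-- Reducing each coordinate modulo m, [1, q m]^r consists of q^r copies of [1, m]^r.
∑-tuples-periodic : ∀ {m} r q (f : ℕ → ℕ) → Periodic m f →
                    ∑ (tuples r (q * m)) (f ∘ productℕ) ≡ q ^ r * ∑ (tuples r m) (f ∘ productℕ)
∑-tuples-periodic           zero    q f periodic = sym (*-identityˡ _)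
∑-tuples-periodic {m = m} (suc r) q f periodic = begin
  ∑ (tuples (suc r) (q * m)) (f ∘ productℕ)
    ≡⟨ ∑-tuples-suc r (q * m) _ ⟩
  ∑ (range1 (q * m)) (λ k → ∑ (tuples r (q * m)) (λ ks → f (k * productℕ ks)))
    ≡⟨ ∑-cong (range1 (q * m)) (λ k → ∑-tuples-periodic r q (λ x → f (k * x)) (scaled k)) ⟩
  ∑ (range1 (q * m)) (λ k → q ^ r * G k)
    ≡⟨ ∑-*ˡ (range1 (q * m)) (q ^ r) G ⟩
  q ^ r * ∑ (range1 (q * m)) G
    ≡⟨ cong (q ^ r *_) (∑-range1-periodic m q G G-periodic) ⟩
  q ^ r * (q * ∑ (range1 m) G)
    ≡⟨ swap-factors (q ^ r) q _ ⟩
  q ^ suc r * ∑ (range1 m) G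
    ≡⟨ cong (q ^ suc r *_) (∑-tuples-suc r m _) ⟨
  q ^ suc r * ∑ (tuples (suc r) m) (f ∘ productℕ)
    ∎
  where
  open ≡-Reasoning
  G : ℕ → ℕ
  G k = ∑ (tuples r m) (λ ks → f (k * productℕ ks))
  swap-factors : ∀ x y z → x * (y * z) ≡ y * x * z
  swap-factors = solve-∀
  scaled : ∀ k → Periodic m (λ x → f (k * x))
  scaled k x y = trans (cong f (distrib k x m y)) (periodic (k * x) (k * y))
    where
    distrib : ∀ k x m y → k * (x + m * y) ≡ k * x + m * (k * y)
    distrib = solve-∀
  G-periodic : ∀ k → G (m + k) ≡ G k
  G-periodic k =
    ∑-cong (tuples r m) (λ ks → trans (cong f (distrib m k (productℕ ks))) (periodic _ _))
    where
    distrib : ∀ m k x → (m + k) * x ≡ k * x + m * x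
    distrib = solve-∀

-- Splitting the gcd sum by the value of gcd k N

fibre : ℕ → ℕ → ℕ → ℕ
fibre r N d =
  ∑ (range1 N) (λ k → 𝟙 (gcd k N * d ≟ N) * ∑ (tuples r N) (λ ks → gcd (k * productℕ ks) N))

∑-divisors-𝟙[gcd*d≡N]≡1 : ∀ N .{{_ : NonZero N}} k →
                          ∑ (divisors N) (λ d → 𝟙 (gcd k N * d ≟ N)) ≡ 1
∑-divisors-𝟙[gcd*d≡N]≡1 N k with gcd[m,n]∣n k N
... | divides v N≡v*g = begin
  ∑ (divisors N) indicator                       ≡⟨ ∑-filter (_∣? N) (range1 N) indicator ⟩
  ∑ (range1 N) (λ d → 𝟙 (d ∣? N) * indicator d)  ≡⟨ ∑-range1-single N _ 1≤v (∣⇒≤ v∣N) vanish ⟩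
  𝟙 (v ∣? N) * indicator v                       ≡⟨ cong₂ _*_ (𝟙-yes (v ∣? N) v∣N) (𝟙-yes (g * v ≟ N) g*v≡N) ⟩
  1                                              ∎
  where
  open ≡-Reasoning
  g = gcd k N
  indicator : ℕ → ℕ
  indicator d = 𝟙 (g * d ≟ N)
  instance
    g≢0 : NonZero g
    g≢0 = ℕ.≢-nonZero (gcd[m,n]≢0 k N (inj₂ (ℕ.≢-nonZero⁻¹ N)))
  g*v≡N : g * v ≡ N
  g*v≡N = trans (*-comm g v) (sym N≡v*g)
  v∣N : v ∣ N
  v∣N = divides g (sym g*v≡N)
  1≤v : 1 ≤ v
  1≤v = n≢0⇒n>0 (λ v≡0 → ℕ.≢-nonZero⁻¹ N (trans N≡v*g (cong (_* g) v≡0)))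
  vanish : ∀ {d} → 1 ≤ d → d ≤ N → d ≢ v → 𝟙 (d ∣? N) * indicator d ≡ 0
  vanish {d} _ _ d≢v = trans (cong (𝟙 (d ∣? N) *_) (𝟙-no (g * d ≟ N) g*d≢N)) (*-zeroʳ (𝟙 (d ∣? N)))
    where
    g*d≢N : g * d ≢ N
    g*d≢N g*d≡N = d≢v (*-cancelˡ-≡ d v g (trans g*d≡N (sym g*v≡N)))

gcdSum-fibres : ∀ r N .{{_ : NonZero N}} → gcdSum (suc r) N ≡ ∑ (divisors N) (fibre r N)
gcdSum-fibres r N = trans (∑-tuples-suc r N _)
  (∑-partition (λ k d → gcd k N * d ≟ N) (range1 N) (divisors N) (∑-divisors-𝟙[gcd*d≡N]≡1 N) _)

fibre-value : ∀ r q d .{{_ : NonZero q}} .{{_ : NonZero d}} →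
              fibre r (q * d) d ≡ φ d * q ^ suc r * gcdSum r d
fibre-value r q d = begin
  fibre r N d
    ≡⟨ ∑-cong (range1 N) weight ⟩
  ∑ (range1 N) (λ k → 𝟙 (gcd k N ≟ q) * (q * H))
    ≡⟨ ∑-*ʳ (range1 N) (q * H) (λ k → 𝟙 (gcd k N ≟ q)) ⟩
  ∑ (range1 N) (λ k → 𝟙 (gcd k N ≟ q)) * (q * H)
    ≡⟨ cong₂ (λ c h → c * (q * h)) (∑-𝟙[gcd[k,q*d]≡q]≡φ[d] q d) H≡ ⟩
  φ d * (q * (q ^ r * gcdSum r d))
    ≡⟨ regroup (φ d) q (q ^ r) (gcdSum r d) ⟩
  φ d * q ^ suc r * gcdSum r d
    ∎
  where
  open ≡-Reasoning
  N = q * d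
  H : ℕ
  H = ∑ (tuples r N) (λ ks → gcd (productℕ ks) d)
  H≡ : H ≡ q ^ r * gcdSum r d
  H≡ = ∑-tuples-periodic r q (λ x → gcd x d) (λ x y → gcd[m+n*o,n]≡gcd[m,n] x d y)
  regroup : ∀ w x y z → w * (x * (y * z)) ≡ w * (x * y) * z
  regroup = solve-∀
  F : ℕ → ℕ
  F k = ∑ (tuples r N) (λ ks → gcd (k * productℕ ks) N)
  F≡q*H : ∀ k → gcd k N ≡ q → F k ≡ q * H
  F≡q*H k gcd≡q =
    trans (∑-cong (tuples r N) (λ ks → gcd[m*o,g*d]≡g*gcd[o,d] {m = k} (productℕ ks) gcd≡q))
          (∑-*ˡ (tuples r N) q (λ ks → gcd (productℕ ks) d))
  weight : ∀ k → 𝟙 (gcd k N * d ≟ N) * F k ≡ 𝟙 (gcd k N ≟ q) * (q * H)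
  weight k = trans
    (cong (_* F k) (𝟙-cong-⇔ (gcd k N * d ≟ N) (gcd k N ≟ q) (*-cancelʳ-≡ (gcd k N) q d) (cong (_* d))))
    (𝟙-*-cong (gcd k N ≟ q) (F≡q*H k))

-- Fractions of naturals

/-cross : ∀ m n c d .{{_ : NonZero c}} .{{_ : NonZero d}} → m * d ≡ n * c → ℤ.+ m / c ≡ ℤ.+ n / d
/-cross m n (suc c) (suc d) eq = fromℚᵘ-cong {mkℚᵘ (ℤ.+ m) c} {mkℚᵘ (ℤ.+ n) d}
  (*≡* (trans (sym (pos-* m (suc d))) (trans (cong ℤ.+_ eq) (pos-* n (suc c)))))

/-+-/ : ∀ m n c d .{{_ : NonZero c}} .{{_ : NonZero d}} →
        ℤ.+ m / c ℚ.+ ℤ.+ n / d ≡ _/_ (ℤ.+ (m * d + n * c)) (c * d) {{m*n≢0 c d}}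
/-+-/ m n c@(suc c-1) d@(suc d-1) = toℚᵘ-injective (begin-equality
  toℚᵘ (ℤ.+ m / c ℚ.+ ℤ.+ n / d)
    ≃⟨ toℚᵘ-homo-+ (ℤ.+ m / c) (ℤ.+ n / d) ⟩
  toℚᵘ (ℤ.+ m / c) ℚᵘ.+ toℚᵘ (ℤ.+ n / d)
    ≃⟨ ℚᵘ.+-cong (toℚᵘ-fromℚᵘ (mkℚᵘ (ℤ.+ m) c-1)) (toℚᵘ-fromℚᵘ (mkℚᵘ (ℤ.+ n) d-1)) ⟩
  mkℚᵘ ((ℤ.+ m) ℤ.* (ℤ.+ d) ℤ.+ (ℤ.+ n) ℤ.* (ℤ.+ c)) (d-1 + c-1 * d)
    ≡⟨ cong (λ i → mkℚᵘ i (d-1 + c-1 * d)) numerator ⟩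
  mkℚᵘ (ℤ.+ (m * d + n * c)) (d-1 + c-1 * d)
    ≃⟨ toℚᵘ-fromℚᵘ _ ⟨
  toℚᵘ (ℤ.+ (m * d + n * c) / (c * d))
    ∎)
  where
  open ℚᵘ.≤-Reasoning
  numerator : (ℤ.+ m) ℤ.* (ℤ.+ d) ℤ.+ (ℤ.+ n) ℤ.* (ℤ.+ c) ≡ ℤ.+ (m * d + n * c)
  numerator = sym (trans (pos-+ (m * d) (n * c)) (cong₂ ℤ._+_ (pos-* m d) (pos-* n c)))

/-*-/ : ∀ m n c d .{{_ : NonZero c}} .{{_ : NonZero d}} →
        (ℤ.+ m / c) ℚ.* (ℤ.+ n / d) ≡ _/_ (ℤ.+ (m * n)) (c * d) {{m*n≢0 c d}}
/-*-/ m n c@(suc c-1) d@(suc d-1) = toℚᵘ-injective (begin-equality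
  toℚᵘ ((ℤ.+ m / c) ℚ.* (ℤ.+ n / d))
    ≃⟨ toℚᵘ-homo-* (ℤ.+ m / c) (ℤ.+ n / d) ⟩
  toℚᵘ (ℤ.+ m / c) ℚᵘ.* toℚᵘ (ℤ.+ n / d)
    ≃⟨ ℚᵘ.*-cong (toℚᵘ-fromℚᵘ (mkℚᵘ (ℤ.+ m) c-1)) (toℚᵘ-fromℚᵘ (mkℚᵘ (ℤ.+ n) d-1)) ⟩
  mkℚᵘ ((ℤ.+ m) ℤ.* (ℤ.+ n)) (d-1 + c-1 * d)
    ≡⟨ cong (λ i → mkℚᵘ i (d-1 + c-1 * d)) (sym (pos-* m n)) ⟩
  mkℚᵘ (ℤ.+ (m * n)) (d-1 + c-1 * d)
    ≃⟨ toℚᵘ-fromℚᵘ _ ⟨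
  toℚᵘ (ℤ.+ (m * n) / (c * d))
    ∎)
  where open ℚᵘ.≤-Reasoning

sumℚ-map-/ : (f : X → ℕ) (c : ℕ) .{{_ : NonZero c}} (xs : List X) →
             sumℚ (map (λ x → ℤ.+ f x / c) xs) ≡ ℤ.+ ∑ xs f / c
sumℚ-map-/ f c []       = sym (0/n≡0 c)
sumℚ-map-/ f c (x ∷ xs) = begin
  ℤ.+ f x / c ℚ.+ sumℚ (map (λ x → ℤ.+ f x / c) xs)
    ≡⟨ cong (ℤ.+ f x / c ℚ.+_) (sumℚ-map-/ f c xs) ⟩
  ℤ.+ f x / c ℚ.+ ℤ.+ ∑ xs f / c
    ≡⟨ /-+-/ (f x) (∑ xs f) c c ⟩
  ℤ.+ (f x * c + ∑ xs f * c) / (c * c)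
    ≡⟨ /-cross (f x * c + ∑ xs f * c) (f x + ∑ xs f) (c * c) c (factor (f x) (∑ xs f) c) ⟩
  ℤ.+ (f x + ∑ xs f) / c
    ∎
  where
  open ≡-Reasoning
  instance
    c*c≢0 : NonZero (c * c)
    c*c≢0 = m*n≢0 c c
  factor : ∀ m n c → (m * c + n * c) * c ≡ (m + n) * (c * c)
  factor = solve-∀

A≡gcdSum/n^r : ∀ r n .{{_ : NonZero n}} → A r n ≡ _/_ (ℤ.+ gcdSum r n) (n ^ r) {{m^n≢0 n r}}
A≡gcdSum/n^r zero    n = /-cross 1 (gcdSum 0 n) 1 1
  (sym (trans (*-identityʳ _) (trans (+-identityʳ _) (gcd-zeroˡ n))))
A≡gcdSum/n^r (suc r) n = refl

^-distribʳ-* : ∀ m n o → (m * n) ^ o ≡ m ^ o * n ^ o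
^-distribʳ-* m n zero    = refl
^-distribʳ-* m n (suc o) =
  trans (cong (m * n *_) (^-distribʳ-* m n o)) (interchange m n (m ^ o) (n ^ o))
  where
  interchange : ∀ w x y z → w * x * (y * z) ≡ w * y * (x * z)
  interchange = solve-∀

fibre/N^[1+r] : ∀ {N} r q d .{{_ : NonZero N}} .{{_ : NonZero d}} → N ≡ q * d →
                _/_ (ℤ.+ fibre r N d) (N ^ suc r) {{m^n≢0 N (suc r)}} ≡
                (ℤ.+ φ d / 1) ℚ.* A r d ℚ.* (ℤ.+ 1 / d)
fibre/N^[1+r] {N} r q d refl = begin
  ℤ.+ fibre r N d / N ^ suc r
    ≡⟨ cong (λ t → ℤ.+ t / N ^ suc r) (fibre-value r q d) ⟩
  ℤ.+ (φ d * q ^ suc r * gcdSum r d) / N ^ suc r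
    ≡⟨ /-cross (φ d * q ^ suc r * gcdSum r d) (φ d * gcdSum r d * 1) (N ^ suc r) (1 * d ^ r * d)
               cross-multiplied ⟩
  ℤ.+ (φ d * gcdSum r d * 1) / (1 * d ^ r * d)
    ≡⟨ /-*-/ (φ d * gcdSum r d) 1 (1 * d ^ r) d ⟨
  (ℤ.+ (φ d * gcdSum r d) / (1 * d ^ r)) ℚ.* (ℤ.+ 1 / d)
    ≡⟨ cong (ℚ._* (ℤ.+ 1 / d)) (/-*-/ (φ d) (gcdSum r d) 1 (d ^ r)) ⟨
  (ℤ.+ φ d / 1) ℚ.* (ℤ.+ gcdSum r d / d ^ r) ℚ.* (ℤ.+ 1 / d)
    ≡⟨ cong (λ a → (ℤ.+ φ d / 1) ℚ.* a ℚ.* (ℤ.+ 1 / d)) (A≡gcdSum/n^r r d) ⟨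
  (ℤ.+ φ d / 1) ℚ.* A r d ℚ.* (ℤ.+ 1 / d)
    ∎
  where
  open ≡-Reasoning
  instance
    q≢0 : NonZero q
    q≢0 = m*n≢0⇒m≢0 q
    N^[1+r]≢0 : NonZero (N ^ suc r)
    N^[1+r]≢0 = m^n≢0 N (suc r)
    d^r≢0 : NonZero (d ^ r)
    d^r≢0 = m^n≢0 d r
    1*d^r≢0 : NonZero (1 * d ^ r)
    1*d^r≢0 = m*n≢0 1 (d ^ r)
    1*d^r*d≢0 : NonZero (1 * d ^ r * d)
    1*d^r*d≢0 = m*n≢0 (1 * d ^ r) d
  regroup : ∀ f s Q D^r D → f * Q * s * (1 * D^r * D) ≡ f * s * 1 * (Q * (D * D^r))
  regroup = solve-∀
  cross-multiplied : φ d * q ^ suc r * gcdSum r d * (1 * d ^ r * d) ≡ φ d * gcdSum r d * 1 * N ^ suc r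
  cross-multiplied = trans (regroup (φ d) (gcdSum r d) (q ^ suc r) (d ^ r) d)
                           (cong (φ d * gcdSum r d * 1 *_) (sym (^-distribʳ-* q d (suc r))))

divisorSum≡∑fibre/N^[1+r] : ∀ r n →
  divisorSum r (suc n) ≡
  sumℚ (map (λ d → _/_ (ℤ.+ fibre r (suc n) d) (suc n ^ suc r) {{m^n≢0 (suc n) (suc r)}}) (divisors (suc n)))
divisorSum≡∑fibre/N^[1+r] r n =
  sym (cong sumℚ (map-cong-local (All.map
    (λ { {zero}  0∣N               → contradiction (0∣⇒≡0 0∣N) λ ()
       ; {suc d} (divides q N≡q*d) → fibre/N^[1+r] r q (suc d) N≡q*d })
    (all-filter (_∣? suc n) (range1 (suc n))))))

proposition3 : (n r : ℕ) → A (suc r) (suc n) ≡ divisorSum r (suc n)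
proposition3 n r = begin
  A (suc r) N
    ≡⟨ cong (λ s → ℤ.+ s / N ^ suc r) (gcdSum-fibres r N) ⟩
  ℤ.+ ∑ (divisors N) (fibre r N) / N ^ suc r
    ≡⟨ sumℚ-map-/ (fibre r N) (N ^ suc r) (divisors N) ⟨
  sumℚ (map (λ d → ℤ.+ fibre r N d / N ^ suc r) (divisors N))
    ≡⟨ divisorSum≡∑fibre/N^[1+r] r n ⟨
  divisorSum r N
    ∎
  where
  open ≡-Reasoning
  N = suc n
  instance
    N^[1+r]≢0 : NonZero (N ^ suc r)
    N^[1+r]≢0 = m^n≢0 N (suc r)
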